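{- For all integers $n,m\ge 0$, $$S_q(n,m)=\sum_{\lambda\vdash n,\ l(\lambda)=m} q^{\sum_i (i-1)(\lambda_i-1)}\sum_{T\in\mathrm{Tab}_{[n]}(\lambda)} c_q(T).$$
   Context: The $q$-Stirling numbers of the second kind are defined by $S_q(n,m)=S_q(n-1,m-1)+[m]_qS_q(n-1,m)$ for $n,m\ge1$, and $S_q(n,m)=\delta_{nm}$ if $n=0$ or $m=0$, where $[a]_q=1+q+\dots+q^{a-1}$. $l(\lambda)$ is the number of parts of $\lambda$, and $\mathrm{Tab}_{[n]}(\lambda)$ is the set of standard tableaux of shape $\lambda$ (fillings of the Young diagram of $\lambda$ with $1,\dots,n$, rows increasing left to right, columns increasing top to bottom). For such $T$ and $2\le j\le\lambda_i$, $c_{ij}(T)=\#\{i'\ge i:\text{cell }(i',j-1)\text{ exists and }T_{i',j-1}<T_{ij}\}$ and $c_q(T)=\prod_i\prod_{j=2}^{\lambda_i}[c_{ij}(T)]_q$. -}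

module Defs where

open import Level using (Level)
open import Data.Nat using (ℕ; zero; suc; _+_; _*_; _∸_; _≤_; _<_; _≥_; _≟_; _≤?_; _<?_)
open import Data.Nat.Properties using (≤-pred)
open import Data.Nat.ListAction using (sum)
open import Data.List using (List; []; _∷_; map; foldr; length; filter; concat; take; upTo; applyUpTo; cartesianProductWith)
open import Data.List.Properties using (≡-dec)
open import Data.List.Relation.Unary.All using (All; all?)
open import Data.List.Relation.Unary.Linked using (Linked; linked?)
open import Data.List.Relation.Binary.Pointwise using (Pointwise; decidable)
open import Data.List.Membership.DecPropositional _≟_ using (_∈_; _∈?_)
open import Data.Maybe using (Maybe; just; nothing)
open import Data.Empty using (⊥)
open import Data.Product using (_×_)
open import Relation.Nullary using (Dec; yes; no; _×-dec_)
open import Relation.Binary.PropositionalEquality using (_≡_)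
open import Algebra.Bundles using (CommutativeSemiring)

words : ℕ → List ℕ → List (List ℕ)
words zero    vs = [] ∷ []
words (suc k) vs = cartesianProductWith _∷_ vs (words k vs)

fillings : List ℕ → List ℕ → List (List (List ℕ))
fillings []       vs = [] ∷ []
fillings (l ∷ ls) vs = cartesianProductWith _∷_ (words l vs) (fillings ls vs)

oneTo : ℕ → List ℕ
oneTo n = applyUpTo suc n

IsPartitionOf : ℕ → List ℕ → Set
IsPartitionOf n sh = All (1 ≤_) sh × Linked _≥_ sh × sum sh ≡ n

isPartitionOf? : (n : ℕ) → (sh : List ℕ) → Dec (IsPartitionOf n sh)
isPartitionOf? n sh = all? (1 ≤?_) sh ×-dec linked? (λ x y → y ≤? x) sh ×-dec (sum sh ≟ n)

partitionsWithParts : ℕ → ℕ → List (List ℕ)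
partitionsWithParts n m = filter (isPartitionOf? n) (words m (upTo (suc n)))

-- Standard tableaux, represented as the list of rows (top to bottom),
-- each row a list of entries (left to right).

-- column condition between a row r and the row s directly below it:
-- every cell of s is strictly larger than the cell of r above it
-- (and r has a cell above every cell of s)
ColBelow : List ℕ → List ℕ → Set
ColBelow r s = Pointwise _<_ (take (length s) r) s

colBelow? : (r s : List ℕ) → Dec (ColBelow r s)
colBelow? r s = decidable _<?_ (take (length s) r) s

IsStdTab : ℕ → List ℕ → List (List ℕ) → Set
IsStdTab n sh T =
  map length T ≡ sh × All (Linked _<_) T × Linked ColBelow T
  × All (_∈ concat T) (oneTo n) × All (All (λ x → 1 ≤ x × x ≤ n)) T

isStdTab? : (n : ℕ) → (sh : List ℕ) → (T : List (List ℕ)) → Dec (IsStdTab n sh T)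
isStdTab? n sh T =
  ≡-dec _≟_ (map length T) sh
  ×-dec all? (linked? _<?_) T
  ×-dec linked? colBelow? T
  ×-dec all? (_∈? concat T) (oneTo n)
  ×-dec all? (all? (λ x → (1 ≤? x) ×-dec (x ≤? n))) T

stdTabs : ℕ → List ℕ → List (List (List ℕ))
stdTabs n sh = filter (isStdTab? n sh) (fillings sh (oneTo n))

at : List ℕ → ℕ → Maybe ℕ
at []       k       = nothing
at (x ∷ xs) zero    = just x
at (x ∷ xs) (suc k) = at xs k

LtM : Maybe ℕ → ℕ → Set
LtM (just a) v = a < v
LtM nothing  v = ⊥

ltM? : (a : Maybe ℕ) → (v : ℕ) → Dec (LtM a v)
ltM? (just a) v = a <? v
ltM? nothing  v = no (λ ())

cnt : List (List ℕ) → ℕ → ℕ → ℕ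
cnt rows k v = length (filter (λ s → ltM? (at s k) v) rows)

-- exponent Σ_i (i-1)(λ_i - 1)  (i 1-indexed; here i 0-indexed)
expoFrom : ℕ → List ℕ → ℕ
expoFrom i []       = 0
expoFrom i (l ∷ ls) = i * (l ∸ 1) + expoFrom (suc i) ls

expo : List ℕ → ℕ
expo = expoFrom 0

-- q-analogues, over an arbitrary commutative semiring (q is a formal
-- variable: an identity in every commutative semiring for every q is an
-- identity in ℕ[q]).

module QAnalogues {c ℓ : Level} (R : CommutativeSemiring c ℓ) where
  open CommutativeSemiring R using (Carrier; 0#; 1#; rawSemiring)
    renaming (_+_ to _⊕_; _*_ to _⊗_)
  open import Algebra.Definitions.RawSemiring rawSemiring using (_^_)

  Σ-list : List Carrier → Carrier
  Σ-list = foldr _⊕_ 0#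

  [_]q : ℕ → Carrier → Carrier
  [ a ]q q = Σ-list (map (q ^_) (upTo a))

  Sq : Carrier → ℕ → ℕ → Carrier
  Sq q zero    zero    = 1#
  Sq q zero    (suc m) = 0#
  Sq q (suc n) zero    = 0#
  Sq q (suc n) (suc m) = Sq q n m ⊕ [ suc m ]q q ⊗ Sq q n (suc m)

  -- product over a row (x ∷ xs) at entries in columns 2,3,...
  -- `rows` = the current row and all rows below it; k = 0-indexed
  -- column of the cell to the left of x.
  rowProd : Carrier → List (List ℕ) → ℕ → List ℕ → Carrier
  rowProd q rows k []       = 1#
  rowProd q rows k (x ∷ xs) = [ cnt rows k x ]q q ⊗ rowProd q rows (suc k) xs

  cqRows : Carrier → List (List ℕ) → Carrier
  cqRows q []               = 1#
  cqRows q (r ∷ rs) with r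
  ... | []     = cqRows q rs
  ... | _ ∷ xs = rowProd q (r ∷ rs) 0 xs ⊗ cqRows q rs

  cq : Carrier → List (List ℕ) → Carrier
  cq = cqRows

  rhs : Carrier → ℕ → ℕ → Carrier
  rhs q n m =
    Σ-list (map (λ μ → q ^ expo μ ⊗ Σ-list (map (cq q) (stdTabs n μ)))
                (partitionsWithParts n m))

module Submission where

-- Weight a standard tableau T of shape λ by q^(Σᵢ (i-1)(λᵢ-1)) c_q(T); the right-hand side is then the total
-- weight S(n,m) of the standard tableaux with n cells and m rows, and it suffices to show that S satisfies the
-- recurrence of S_q. Deleting the largest entry N = n+1 from a tableau with N cells and m+1 rows leaves a tableau
-- with n cells: either N formed the last row on its own, and the smaller tableau has m rows and the same weight,
-- or N ended a row strictly shorter than the row above it. Being the largest entry, N changes no other cell's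
-- factor of c_q, so appending N to the i-th row multiplies the weight by q^(i-1)[k]_q, where k is the number of
-- rows from the i-th on that have its length. In a block of k equal rows only the top one admits N, and
-- q^(i-1)[k]_q has one power of q per row of the block, so the tableaux arising from one with m+1 rows weigh
-- [m+1]_q times as much.

open import Defs
open import Level using (Level)
open import Algebra.Bundles using (CommutativeSemiring)
open import Data.Empty using (⊥; ⊥-elim)
open import Data.List using (List; []; _∷_; [_]; _++_; map; length; concat; concatMap; filter; upTo; applyUpTo)
open import Data.List.Properties
  using (length-map; length-++; length-applyUpTo; applyUpTo-∷ʳ; ∷-injective; ∷ʳ-injective; ++-assoc;
         filter-accept; filter-reject)
open import Data.List.Membership.Propositional using (_∈_; _∉_; find; lose)
open import Data.List.Membership.Propositional.Properties
  using (∈-filter⁺; ∈-filter⁻; ∈-cartesianProductWith⁺; ∈-cartesianProductWith⁻; ∈-concatMap⁺; ∈-concatMap⁻;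
         ∈-applyUpTo⁺; ∈-applyUpTo⁻; ∈-upTo⁺; ∈-map⁺; ∈-map⁻; ∈-++⁺ʳ; ∈-++⁺ˡ; ∈-++⁻; ∈-∃++)
open import Data.List.Membership.Propositional.Properties.WithK using (unique∧set⇒bag)
open import Data.List.Relation.Binary.BagAndSetEquality using (∼bag⇒↭)
open import Data.List.Relation.Binary.Permutation.Propositional
  using (_↭_; ↭-refl; ↭-sym; ↭-trans; ↭-prep; ↭⇒↭ₛ; ↭⇒↭ₛ′; module PermutationReasoning)
import Data.List.Relation.Binary.Permutation.Propositional.Properties as ↭
open ↭ using (∈-resp-↭; All-resp-↭; ↭-length; shift; ∷↭∷ʳ; drop-∷; ++⁺ˡ)
open import Data.List.Relation.Binary.Permutation.Setoid.Properties using (foldr-commMonoid)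
open import Data.List.Relation.Binary.Pointwise using ([]; _∷_)
open import Data.List.Relation.Unary.All as All using (All; []; _∷_)
import Data.List.Relation.Unary.All.Properties as All
open import Data.List.Relation.Unary.AllPairs using ([]; _∷_)
open import Data.List.Relation.Unary.Any using (here; there)
open import Data.List.Relation.Unary.Linked using (Linked; []; [-]; _∷_)
open import Data.List.Relation.Unary.Unique.Propositional using (Unique)
import Data.List.Relation.Unary.Unique.Propositional.Properties as Unique
open import Data.Maybe using (just; nothing)
open import Data.Nat using (ℕ; zero; suc; _+_; _*_; _∸_; _≤_; _<_; _≥_; z≤n; s≤s; _<?_; _≤?_)
import Data.Nat.Properties as ℕₚ
open import Data.Nat.ListAction using (sum)
open import Data.Product using (_×_; _,_; proj₁; proj₂; ∃)
open import Data.Sum using (_⊎_; inj₁; inj₂)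
open import Function using (_∘_)
open import Function.Bundles using (_⇔_; mk⇔)
open import Relation.Binary.Core using (Rel)
open import Relation.Nullary using (Dec; yes; no; ¬_)
import Relation.Binary.PropositionalEquality as ≡
open ≡ using (_≡_; _≢_)
open import Data.List.Relation.Binary.Permutation.Setoid.Properties (≡.setoid ℕ) using (Unique-resp-↭)

onlyIf : ∀ {a q} {A : Set a} {Q : Set q} → Dec Q → A → List A
onlyIf (yes _) x = [ x ]
onlyIf (no _)  _ = []

module ListProperties where

  open ≡ using (refl; cong)
  open ℕₚ using (<-irrefl; <-trans; <-≤-trans)

  module _ {a} {A : Set a} where

    concatMap-unique : ∀ {b} {B : Set b} (f : A → List B) {xs} → Unique xs → (∀ {x} → x ∈ xs → Unique (f x)) →
                       (∀ {x x′ y} → x ∈ xs → x′ ∈ xs → y ∈ f x → y ∈ f x′ → x ≡ x′) → Unique (concatMap f xs)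
    concatMap-unique f {[]}     _            _     _    = []
    concatMap-unique f {x ∷ xs} (x∉xs ∷ xs!) f-unique same =
      Unique.++⁺ (f-unique (here refl))
                 (concatMap-unique f xs! (f-unique ∘ there) λ x∈ x′∈ → same (there x∈) (there x′∈))
                 λ (y∈fx , y∈rest) → let x′ , x′∈ , y∈fx′ = find (∈-concatMap⁻ f {xs = xs} y∈rest)
                                     in All.lookup x∉xs x′∈ (same (here refl) (there x′∈) y∈fx y∈fx′)

    []≢∷ʳ : ∀ (xs : List A) {x} → [] ≢ xs ++ [ x ]
    []≢∷ʳ []      ()
    []≢∷ʳ (_ ∷ _) ()

    Unique-++⁻ : ∀ (xs : List A) {ys} → Unique (xs ++ ys) → Unique ys × (∀ {x} → x ∈ xs → x ∈ ys → ⊥)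
    Unique-++⁻ []       ys!          = ys! , λ ()
    Unique-++⁻ (y ∷ xs) (y∉ ∷ xsys!) with ys! , xs#ys ← Unique-++⁻ xs xsys! = ys! , λ where
      (here refl) x∈ys → All.lookup y∉ (∈-++⁺ʳ xs x∈ys) refl
      (there x∈xs) x∈ys → xs#ys x∈xs x∈ys

    ∷ʳ≢ : ∀ (xs : List A) {x} → xs ++ [ x ] ≢ xs
    ∷ʳ≢ []       ()
    ∷ʳ≢ (_ ∷ xs) eq = ∷ʳ≢ xs (proj₂ (∷-injective eq))

    Linked-∷ʳ⁺ : ∀ {r} {R : Rel A r} {xs y} → Linked R xs → All (λ x → R x y) xs → Linked R (xs ++ [ y ])
    Linked-∷ʳ⁺ []        []            = [-]
    Linked-∷ʳ⁺ [-]       (Rxy ∷ [])    = Rxy ∷ [-]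
    Linked-∷ʳ⁺ (R ∷ Rxs) (_ ∷ Rxsy)    = R ∷ Linked-∷ʳ⁺ Rxs Rxsy

    Linked-++⁻ˡ : ∀ {r} {R : Rel A r} xs {ys} → Linked R (xs ++ ys) → Linked R xs
    Linked-++⁻ˡ []           _         = []
    Linked-++⁻ˡ (x ∷ [])     _         = [-]
    Linked-++⁻ˡ (x ∷ y ∷ xs) (R ∷ Rxs) = R ∷ Linked-++⁻ˡ (y ∷ xs) Rxs

  Linked-<-last : ∀ {row x} → Linked _<_ row → All (_≤ x) row → x ∈ row → ∃ λ r → row ≡ r ++ [ x ]
  Linked-<-last {_ ∷ []}    _          _             (here refl) = [] , refl
  Linked-<-last {_ ∷ _ ∷ _} (a<b ∷ _)  (_ ∷ b≤x ∷ _) (here refl) = ⊥-elim (<-irrefl refl (<-≤-trans a<b b≤x))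
  Linked-<-last {a ∷ _ ∷ _} (_ ∷ row↑) (_ ∷ row≤x)   (there x∈)
    with r , eq ← Linked-<-last row↑ row≤x x∈ = a ∷ r , cong (a ∷_) eq

  Linked-<-∷ʳ⁻ : ∀ r {x} → Linked _<_ (r ++ [ x ]) → All (_< x) r
  Linked-<-∷ʳ⁻ []          _               = []
  Linked-<-∷ʳ⁻ (_ ∷ [])    (a<x ∷ [-])     = a<x ∷ []
  Linked-<-∷ʳ⁻ (_ ∷ b ∷ r) (a<b ∷ r↑) with b<x ∷ r<x ← Linked-<-∷ʳ⁻ (b ∷ r) r↑ = <-trans a<b b<x ∷ b<x ∷ r<x

open ListProperties

module ListSum {c ℓ : Level} (R : CommutativeSemiring c ℓ) where
  open CommutativeSemiring R renaming (_+_ to _⊕_; _*_ to _⊗_)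
  open QAnalogues R using (Σ-list)
  open import Relation.Binary.Reasoning.Setoid setoid

  ∑ : ∀ {a} {A : Set a} → (A → Carrier) → List A → Carrier
  ∑ f xs = Σ-list (map f xs)

  module _ {a} {A : Set a} where

    ∑-++ : (f : A → Carrier) (xs ys : List A) → ∑ f (xs ++ ys) ≈ ∑ f xs ⊕ ∑ f ys
    ∑-++ f []       ys = sym (+-identityˡ _)
    ∑-++ f (x ∷ xs) ys = begin
      f x ⊕ ∑ f (xs ++ ys)      ≈⟨ +-congˡ (∑-++ f xs ys) ⟩
      f x ⊕ (∑ f xs ⊕ ∑ f ys)   ≈⟨ +-assoc _ _ _ ⟨
      (f x ⊕ ∑ f xs) ⊕ ∑ f ys   ∎

    ∑-cong : {f g : A → Carrier} (xs : List A) → (∀ {x} → x ∈ xs → f x ≈ g x) → ∑ f xs ≈ ∑ g xs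
    ∑-cong []       f≈g = refl
    ∑-cong (x ∷ xs) f≈g = +-cong (f≈g (here ≡.refl)) (∑-cong xs (f≈g ∘ there))

    ∑-∉ : (f : A → Carrier) {xs : List A} → (∀ {x} → x ∉ xs) → ∑ f xs ≈ 0#
    ∑-∉ f {[]}    _     = refl
    ∑-∉ f {_ ∷ _} empty = ⊥-elim (empty (here ≡.refl))

    *-distribˡ-∑ : (k : Carrier) (f : A → Carrier) (xs : List A) → k ⊗ ∑ f xs ≈ ∑ (λ x → k ⊗ f x) xs
    *-distribˡ-∑ k f []       = zeroʳ k
    *-distribˡ-∑ k f (x ∷ xs) = trans (distribˡ k _ _) (+-congˡ (*-distribˡ-∑ k f xs))

    ∑-onlyIf-yes : ∀ {q} {Q : Set q} (f : A → Carrier) (Q? : Dec Q) → Q → ∀ x ys →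
                   ∑ f (onlyIf Q? x ++ ys) ≈ f x ⊕ ∑ f ys
    ∑-onlyIf-yes f (yes _) _ x ys = refl
    ∑-onlyIf-yes f (no ¬q) q x ys = ⊥-elim (¬q q)

    ∑-onlyIf-no : ∀ {q} {Q : Set q} (f : A → Carrier) (Q? : Dec Q) → ¬ Q → ∀ x ys →
                  ∑ f (onlyIf Q? x ++ ys) ≈ ∑ f ys
    ∑-onlyIf-no f (yes q) ¬q x ys = ⊥-elim (¬q q)
    ∑-onlyIf-no f (no _)  _  x ys = refl

    ∑-↭ : (f : A → Carrier) {xs ys : List A} → xs ↭ ys → ∑ f xs ≈ ∑ f ys
    ∑-↭ f xs↭ys = foldr-commMonoid setoid +-isCommutativeMonoid (↭⇒↭ₛ′ isEquivalence (↭.map⁺ f xs↭ys))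

    ∑-sameElements : (f : A → Carrier) {xs ys : List A} → Unique xs → Unique ys →
                     (∀ {x} → x ∈ xs ⇔ x ∈ ys) → ∑ f xs ≈ ∑ f ys
    ∑-sameElements f xs! ys! xs≈ys = ∑-↭ f (∼bag⇒↭ (unique∧set⇒bag xs! ys! xs≈ys))

  module _ {a b} {A : Set a} {B : Set b} where

    ∑-map : (f : B → Carrier) (g : A → B) (xs : List A) → ∑ f (map g xs) ≈ ∑ (f ∘ g) xs
    ∑-map f g []       = refl
    ∑-map f g (x ∷ xs) = +-congˡ (∑-map f g xs)

    ∑-concatMap : (f : B → Carrier) (g : A → List B) (xs : List A) → ∑ f (concatMap g xs) ≈ ∑ (∑ f ∘ g) xs
    ∑-concatMap f g []       = refl
    ∑-concatMap f g (x ∷ xs) = trans (∑-++ f (g x) (concatMap g xs)) (+-congˡ (∑-concatMap f g xs))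

module Tableaux where

  open ≡ using (refl; sym; trans; cong; cong₂; subst)
  open ℕₚ using (≤-refl; ≤-trans; <-trans; <-≤-trans; ≤∧≢⇒<; <-irrefl; <⇒≢; m≤m+n; m≤n+m; m≤n⇒m≤1+n; n<1+n;
                 +-suc; +-comm; suc-injective)

  ∈-words⁻ : ∀ k vs {w} → w ∈ words k vs → length w ≡ k × All (_∈ vs) w
  ∈-words⁻ zero    vs (here refl) = refl , []
  ∈-words⁻ (suc k) vs w∈ with ∈-cartesianProductWith⁻ _∷_ vs (words k vs) w∈
  ... | v , w , v∈ , w∈′ , refl with ∈-words⁻ k vs w∈′
  ...   | |w|≡k , w⊆vs = cong suc |w|≡k , v∈ ∷ w⊆vs

  ∈-words⁺ : ∀ vs {w} → All (_∈ vs) w → w ∈ words (length w) vs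
  ∈-words⁺ vs []         = here refl
  ∈-words⁺ vs (v∈ ∷ w⊆vs) = ∈-cartesianProductWith⁺ _∷_ v∈ (∈-words⁺ vs w⊆vs)

  ∈-fillings⁻ : ∀ sh vs {T} → T ∈ fillings sh vs → map length T ≡ sh
  ∈-fillings⁻ []       vs (here refl) = refl
  ∈-fillings⁻ (l ∷ sh) vs T∈ with ∈-cartesianProductWith⁻ _∷_ (words l vs) (fillings sh vs) T∈
  ... | r , T , r∈ , T∈′ , refl = cong₂ _∷_ (proj₁ (∈-words⁻ l vs r∈)) (∈-fillings⁻ sh vs T∈′)

  ∈-fillings⁺ : ∀ vs {T} → All (All (_∈ vs)) T → T ∈ fillings (map length T) vs
  ∈-fillings⁺ vs []         = here refl
  ∈-fillings⁺ vs (r⊆vs ∷ T⊆vs) = ∈-cartesianProductWith⁺ _∷_ (∈-words⁺ vs r⊆vs) (∈-fillings⁺ vs T⊆vs)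

  words-unique : ∀ k vs → Unique vs → Unique (words k vs)
  words-unique zero    vs vs! = [] ∷ []
  words-unique (suc k) vs vs! = Unique.cartesianProductWith⁺ _∷_ ∷-injective vs! (words-unique k vs vs!)

  fillings-unique : ∀ sh vs → Unique vs → Unique (fillings sh vs)
  fillings-unique []       vs vs! = [] ∷ []
  fillings-unique (l ∷ sh) vs vs! =
    Unique.cartesianProductWith⁺ _∷_ ∷-injective (words-unique l vs vs!) (fillings-unique sh vs vs!)

  oneTo-unique : ∀ n → Unique (oneTo n)
  oneTo-unique n = Unique.applyUpTo⁺₁ suc n (λ i<j _ → <⇒≢ i<j ∘ suc-injective)

  ∈-oneTo⁺ : ∀ {n x} → 1 ≤ x → x ≤ n → x ∈ oneTo n
  ∈-oneTo⁺ {x = suc x} (s≤s z≤n) x≤n = ∈-applyUpTo⁺ suc x≤n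

  ∈-oneTo⁻ : ∀ {n x} → x ∈ oneTo n → 1 ≤ x × x ≤ n
  ∈-oneTo⁻ x∈ with ∈-applyUpTo⁻ suc x∈
  ... | i , i<n , refl = s≤s z≤n , i<n

  ∈⇒≤sum : ∀ {x xs} → x ∈ xs → x ≤ sum xs
  ∈⇒≤sum {xs = y ∷ ys} (here refl) = m≤m+n y (sum ys)
  ∈⇒≤sum {xs = y ∷ ys} (there x∈) = ≤-trans (∈⇒≤sum x∈) (m≤n+m (sum ys) y)

  ColBelow⇒≤ : ∀ {r s} → ColBelow r s → length s ≤ length r
  ColBelow⇒≤ {r}     {[]}    _            = z≤n
  ColBelow⇒≤ {_ ∷ r} {_ ∷ s} (_ ∷ r<s) = s≤s (ColBelow⇒≤ r<s)

  shape-decreasing : ∀ {T} → Linked ColBelow T → Linked _≥_ (map length T)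
  shape-decreasing []          = []
  shape-decreasing [-]         = [-]
  shape-decreasing (r<s ∷ col) = ColBelow⇒≤ r<s ∷ shape-decreasing col

  length-concat : (T : List (List ℕ)) → length (concat T) ≡ sum (map length T)
  length-concat []       = refl
  length-concat (r ∷ rs) = trans (length-++ r) (cong (length r +_) (length-concat rs))

  oneTo-suc↭ : ∀ n → oneTo (suc n) ↭ suc n ∷ oneTo n
  oneTo-suc↭ n = begin
    oneTo (suc n)         ≡⟨ applyUpTo-∷ʳ suc n ⟨
    oneTo n ++ [ suc n ]  ↭⟨ ∷↭∷ʳ (suc n) (oneTo n) ⟨
    suc n ∷ oneTo n       ∎
    where open PermutationReasoning

  covering⇒↭oneTo : ∀ n {L} → length L ≡ n → All (_∈ L) (oneTo n) → L ↭ oneTo n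
  covering⇒↭oneTo zero    {[]} _ _ = ↭-refl
  covering⇒↭oneTo (suc n) {L} |L|≡1+n covers
    with as , bs , refl ← ∈-∃++ (All.lookup covers (∈-oneTo⁺ (s≤s z≤n) ≤-refl)) = begin
    as ++ suc n ∷ bs      ↭⟨ shift (suc n) as bs ⟩
    suc n ∷ (as ++ bs)    ↭⟨ ↭-prep (suc n) (covering⇒↭oneTo n |as++bs|≡n (All.tabulate covered)) ⟩
    suc n ∷ oneTo n       ↭⟨ oneTo-suc↭ n ⟨
    oneTo (suc n)         ∎
    where
    open PermutationReasoning
    |as++bs|≡n : length (as ++ bs) ≡ n
    |as++bs|≡n = suc-injective (trans (trans (cong suc (length-++ as)) (sym (+-suc (length as) (length bs))))
                                        (trans (sym (length-++ as)) |L|≡1+n))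
    covered : ∀ {x} → x ∈ oneTo n → x ∈ as ++ bs
    covered x∈ with 1≤x , x≤n ← ∈-oneTo⁻ x∈
                   | ∈-resp-↭ (shift (suc n) as bs) (All.lookup covers (∈-oneTo⁺ 1≤x (m≤n⇒m≤1+n x≤n)))
    ... | here refl  = ⊥-elim (<-irrefl refl (s≤s x≤n))
    ... | there x∈′ = x∈′

  ColBelow-∷ʳ-lower⁺ : ∀ {r s x} → ColBelow r s → length s < length r → All (_< x) r → ColBelow r (s ++ [ x ])
  ColBelow-∷ʳ-lower⁺ {_ ∷ _} {[]}    _           _         (a<x ∷ _) = a<x ∷ []
  ColBelow-∷ʳ-lower⁺ {_ ∷ _} {_ ∷ _} (a<b ∷ r<s) (s≤s |s|<|r|) (_ ∷ r<x) = a<b ∷ ColBelow-∷ʳ-lower⁺ r<s |s|<|r| r<x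

  ColBelow-∷ʳ-lower⁻ : ∀ {r s x} → ColBelow r (s ++ [ x ]) → ColBelow r s
  ColBelow-∷ʳ-lower⁻ {s = []}    _           = []
  ColBelow-∷ʳ-lower⁻ {_ ∷ _} {_ ∷ _} (a<b ∷ r<s) = a<b ∷ ColBelow-∷ʳ-lower⁻ r<s

  ColBelow-∷ʳ-upper⁺ : ∀ {r s x} → ColBelow r s → ColBelow (r ++ [ x ]) s
  ColBelow-∷ʳ-upper⁺ {s = []}    _           = []
  ColBelow-∷ʳ-upper⁺ {_ ∷ _} {_ ∷ _} (a<b ∷ r<s) = a<b ∷ ColBelow-∷ʳ-upper⁺ r<s

  ColBelow-∷ʳ-upper⁻ : ∀ {r s x} → ColBelow (r ++ [ x ]) s → All (_< x) s → ColBelow r s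
  ColBelow-∷ʳ-upper⁻ {s = []}    _           _         = []
  ColBelow-∷ʳ-upper⁻ {_ ∷ _} {_ ∷ _} (a<b ∷ r<s) (_ ∷ s<x) = a<b ∷ ColBelow-∷ʳ-upper⁻ r<s s<x
  ColBelow-∷ʳ-upper⁻ {[]}    {_ ∷ _} (x<b ∷ _)   (b<x ∷ _) = ⊥-elim (<-irrefl refl (<-trans x<b b<x))

  NonEmptyRows : List (List ℕ) → Set
  NonEmptyRows T = All (λ r → 1 ≤ length r) T

  -- The conditions of IsStdTab and IsPartitionOf, with the entries stated as a permutation of 1, …, n.
  record IsTableau (n : ℕ) (T : List (List ℕ)) : Set where
    field
      rowsNonEmpty      : NonEmptyRows T
      rowsIncreasing    : All (Linked _<_) T
      columnsIncreasing : Linked ColBelow T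
      entries           : concat T ↭ oneTo n

  IsTableau-size : ∀ {n T} → IsTableau n T → sum (map length T) ≡ n
  IsTableau-size {n} {T} t =
    trans (sym (length-concat T)) (trans (↭-length (IsTableau.entries t)) (length-applyUpTo suc n))

  tableaux : ℕ → ℕ → List (List (List ℕ))
  tableaux n m = concatMap (stdTabs n) (partitionsWithParts n m)

  ∈-stdTabs⁻ : ∀ {n μ T} → T ∈ stdTabs n μ → IsStdTab n μ T
  ∈-stdTabs⁻ {n} {μ} T∈ = proj₂ (∈-filter⁻ (isStdTab? n μ) {xs = fillings μ (oneTo n)} T∈)

  ∈-tableaux⁻ : ∀ n m {T} → T ∈ tableaux n m → IsTableau n T × length T ≡ m
  ∈-tableaux⁻ n m {T} T∈
    with μ , μ∈ , T∈μ ← find (∈-concatMap⁻ (stdTabs n) {xs = partitionsWithParts n m} T∈)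
    with refl , inc , col , cov , _ ← ∈-stdTabs⁻ {n} {μ} T∈μ
       | μ∈words , nonEmpty , _ , size ← ∈-filter⁻ (isPartitionOf? n) {xs = words m (upTo (suc n))} μ∈ =
    record { rowsNonEmpty = All.map⁻ nonEmpty ; rowsIncreasing = inc ; columnsIncreasing = col
           ; entries = covering⇒↭oneTo n (trans (length-concat T) size) cov }
    , trans (sym (length-map length T)) (proj₁ (∈-words⁻ m _ μ∈words))

  ∈-tableaux⁺ : ∀ {n m T} → IsTableau n T → length T ≡ m → T ∈ tableaux n m
  ∈-tableaux⁺ {n} {m} {T} t |T|≡m = ∈-concatMap⁺ (stdTabs n) (lose μ∈ T∈μ)
    where
    open IsTableau t
    μ = map length T
    size : sum μ ≡ n
    size = IsTableau-size t
    inRange : All (All (λ x → 1 ≤ x × x ≤ n)) T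
    inRange = All.concat⁻ (All-resp-↭ (↭-sym entries) (All.tabulate ∈-oneTo⁻))
    μ∈words : μ ∈ words m (upTo (suc n))
    μ∈words = subst (λ k → μ ∈ words k (upTo (suc n))) (trans (length-map length T) |T|≡m)
                (∈-words⁺ _ (All.tabulate (λ l∈ → ∈-upTo⁺ (s≤s (subst (_ ≤_) size (∈⇒≤sum l∈))))))
    μ∈ : μ ∈ partitionsWithParts n m
    μ∈ = ∈-filter⁺ (isPartitionOf? n) μ∈words (All.map⁺ rowsNonEmpty , shape-decreasing columnsIncreasing , size)
    T∈μ : T ∈ stdTabs n μ
    T∈μ = ∈-filter⁺ (isStdTab? n μ)
            (∈-fillings⁺ (oneTo n) (All.map (All.map λ (1≤x , x≤n) → ∈-oneTo⁺ 1≤x x≤n) inRange))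
            (refl , rowsIncreasing , columnsIncreasing , All.tabulate (∈-resp-↭ (↭-sym entries)) , inRange)

  tableaux-unique : ∀ n m → Unique (tableaux n m)
  tableaux-unique n m = concatMap-unique (stdTabs n) partitions-unique (λ {μ} _ → stdTabs-unique μ) same-shape
    where
    partitions-unique : Unique (partitionsWithParts n m)
    partitions-unique = Unique.filter⁺ (isPartitionOf? n) (words-unique m _ (Unique.upTo⁺ (suc n)))
    stdTabs-unique : ∀ μ → Unique (stdTabs n μ)
    stdTabs-unique μ = Unique.filter⁺ (isStdTab? n μ) (fillings-unique μ _ (oneTo-unique n))
    same-shape : ∀ {μ ν T} → μ ∈ partitionsWithParts n m → ν ∈ partitionsWithParts n m →
                 T ∈ stdTabs n μ → T ∈ stdTabs n ν → μ ≡ ν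
    same-shape {μ} {ν} _ _ T∈μ T∈ν = trans (sym (proj₁ (∈-stdTabs⁻ {n} {μ} T∈μ))) (proj₁ (∈-stdTabs⁻ {n} {ν} T∈ν))

  module Growth (n : ℕ) where

    N : ℕ
    N = suc n

    BelowN : List (List ℕ) → Set
    BelowN T = All (All (_< N)) T

    isTableau⇒belowN : ∀ {T} → IsTableau n T → BelowN T
    isTableau⇒belowN t = All.concat⁻ (All-resp-↭ (↭-sym (IsTableau.entries t))
                                                   (All.tabulate λ x∈ → s≤s (proj₂ (∈-oneTo⁻ x∈))))

    withNewRow : List (List ℕ) → List (List ℕ)
    withNewRow T = T ++ [ [ N ] ]

    -- p is the length of the row above the one receiving N.
    data InsertedBelow : ℕ → List (List ℕ) → List (List ℕ) → Set where
      here  : ∀ {p r rs}    → length r < p → InsertedBelow p (r ∷ rs) ((r ++ [ N ]) ∷ rs)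
      there : ∀ {p r rs ys} → InsertedBelow (length r) rs ys → InsertedBelow p (r ∷ rs) (r ∷ ys)

    insertionsBelow : ℕ → List (List ℕ) → List (List (List ℕ))
    insertionsBelow p []       = []
    insertionsBelow p (r ∷ rs) =
      onlyIf (length r <? p) ((r ++ [ N ]) ∷ rs) ++ map (r ∷_) (insertionsBelow (length r) rs)

    insertions : List (List ℕ) → List (List (List ℕ))
    insertions []       = []
    insertions (r ∷ rs) = insertionsBelow (suc (length r)) (r ∷ rs)

    ∈-insertionsBelow⁻ : ∀ p T {y} → y ∈ insertionsBelow p T → InsertedBelow p T y
    ∈-insertionsBelow⁻ p (r ∷ rs) y∈ with length r <? p
    ... | yes |r|<p with y∈
    ...   | here refl = here |r|<p
    ...   | there y∈′ with ys , ys∈ , refl ← ∈-map⁻ (r ∷_) y∈′ = there (∈-insertionsBelow⁻ (length r) rs ys∈)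
    ∈-insertionsBelow⁻ p (r ∷ rs) y∈ | no _
      with ys , ys∈ , refl ← ∈-map⁻ (r ∷_) y∈ = there (∈-insertionsBelow⁻ (length r) rs ys∈)

    ∈-insertionsBelow⁺ : ∀ {p T y} → InsertedBelow p T y → y ∈ insertionsBelow p T
    ∈-insertionsBelow⁺ {p} {r ∷ _} (here |r|<p) with length r <? p
    ... | yes _    = here refl
    ... | no |r|≮p = ⊥-elim (|r|≮p |r|<p)
    ∈-insertionsBelow⁺ {p} {r ∷ _} (there i) with length r <? p
    ... | yes _ = there (∈-map⁺ (r ∷_) (∈-insertionsBelow⁺ i))
    ... | no _  = ∈-map⁺ (r ∷_) (∈-insertionsBelow⁺ i)

    ∈-insertions⁻ : ∀ T {y} → y ∈ insertions T → ∃ λ p → InsertedBelow p T y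
    ∈-insertions⁻ (r ∷ rs) y∈ = _ , ∈-insertionsBelow⁻ _ (r ∷ rs) y∈

    ∈-insertions⁺ : ∀ {p T y} → InsertedBelow p T y → y ∈ insertions T
    ∈-insertions⁺ (here _)  = ∈-insertionsBelow⁺ (here (n<1+n _))
    ∈-insertions⁺ (there i) = ∈-insertionsBelow⁺ (there i)

    insertionsBelow-unique : ∀ p T → Unique (insertionsBelow p T)
    insertionsBelow-unique p []       = []
    insertionsBelow-unique p (r ∷ rs) with length r <? p
    ... | yes _ = All.tabulate head≢ ∷ rest-unique
      where
      rest-unique : Unique (map (r ∷_) (insertionsBelow (length r) rs))
      rest-unique = Unique.map⁺ (proj₂ ∘ ∷-injective) (insertionsBelow-unique (length r) rs)
      head≢ : ∀ {y} → y ∈ map (r ∷_) (insertionsBelow (length r) rs) → (r ++ [ N ]) ∷ rs ≢ y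
      head≢ y∈ eq with _ , _ , refl ← ∈-map⁻ (r ∷_) y∈ = ∷ʳ≢ r (proj₁ (∷-injective eq))
    ... | no _  = Unique.map⁺ (proj₂ ∘ ∷-injective) (insertionsBelow-unique (length r) rs)

    private
      ∉-∷ʳN : ∀ {r} → All (_< N) (r ++ [ N ]) → ⊥
      ∉-∷ʳN {r} r<N with N<N ∷ [] ← All.++⁻ʳ r r<N = <-irrefl refl N<N

    inserted-injective : ∀ {p p′ T T′ y y′} → InsertedBelow p T y → InsertedBelow p′ T′ y′ →
                         BelowN T → BelowN T′ → y ≡ y′ → T ≡ T′
    inserted-injective {T = r ∷ _} {r′ ∷ _} (here _) (here _) _ _ eq
      with r++N≡r′++N , refl ← ∷-injective eq
      with refl , _ ← ∷ʳ-injective r r′ r++N≡r′++N = refl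
    inserted-injective (here _)  (there _) _ (r′<N ∷ _) eq with refl , _ ← ∷-injective eq = ⊥-elim (∉-∷ʳN r′<N)
    inserted-injective (there _) (here _)  (r<N ∷ _) _ eq with refl , _ ← ∷-injective eq = ⊥-elim (∉-∷ʳN r<N)
    inserted-injective (there i) (there i′) (_ ∷ T<N) (_ ∷ T′<N) eq with refl , ys≡ys′ ← ∷-injective eq =
      cong (_ ∷_) (inserted-injective i i′ T<N T′<N ys≡ys′)

    withNewRow≢inserted : ∀ {p T T′ y} → InsertedBelow p T′ y → BelowN T → BelowN T′ → NonEmptyRows T′ →
                          withNewRow T ≢ y
    withNewRow≢inserted {T = []} {[] ∷ _} (here _) _ _ (() ∷ _) _
    withNewRow≢inserted {T = []} {(_ ∷ r) ∷ _} (here _) _ _ _ eq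
      with _ , []≡r++N ← ∷-injective (proj₁ (∷-injective eq)) = []≢∷ʳ r []≡r++N
    withNewRow≢inserted {T = []}    (there _) _          ((N<N ∷ _) ∷ _) _    refl = <-irrefl refl N<N
    withNewRow≢inserted {T = _ ∷ _} (here _)  (r<N ∷ _)  _           _        eq
      with refl , _ ← ∷-injective eq = ∉-∷ʳN r<N
    withNewRow≢inserted {T = _ ∷ _} (there i) (_ ∷ T<N)  (_ ∷ T′<N)  (_ ∷ T′≠[]) eq
      with refl , eq′ ← ∷-injective eq = withNewRow≢inserted i T<N T′<N T′≠[] eq′

    inserted-length : ∀ {p T y} → InsertedBelow p T y → length y ≡ length T
    inserted-length (here _)  = refl
    inserted-length (there i) = cong suc (inserted-length i)

    withNewRow-length : ∀ T → length (withNewRow T) ≡ suc (length T)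
    withNewRow-length T = trans (length-++ T) (+-comm (length T) 1)

    grownTableaux : ℕ → List (List (List ℕ))
    grownTableaux m = map withNewRow (tableaux n m) ++ concatMap insertions (tableaux n (suc m))

    grownTableaux-unique : ∀ m → Unique (grownTableaux m)
    grownTableaux-unique m =
      Unique.++⁺ (Unique.map⁺ (proj₁ ∘ ∷ʳ-injective _ _) (tableaux-unique n m))
                 (concatMap-unique insertions (tableaux-unique n (suc m)) (λ {T} _ → insertions-unique T)
                                   same-origin)
                 newRow-disjoint
      where
      insertions-unique : ∀ T → Unique (insertions T)
      insertions-unique []       = []
      insertions-unique (r ∷ rs) = insertionsBelow-unique _ (r ∷ rs)
      belowN-of : ∀ {T} → T ∈ tableaux n (suc m) → BelowN T
      belowN-of T∈ = isTableau⇒belowN (proj₁ (∈-tableaux⁻ n (suc m) T∈))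
      same-origin : ∀ {T T′ y} → T ∈ tableaux n (suc m) → T′ ∈ tableaux n (suc m) →
                    y ∈ insertions T → y ∈ insertions T′ → T ≡ T′
      same-origin {T} {T′} T∈ T′∈ y∈ y∈′ with _ , i ← ∈-insertions⁻ T y∈ | _ , i′ ← ∈-insertions⁻ T′ y∈′ =
        inserted-injective i i′ (belowN-of T∈) (belowN-of T′∈) refl
      newRow-disjoint : ∀ {y} → y ∈ map withNewRow (tableaux n m) × y ∈ concatMap insertions (tableaux n (suc m)) →
                        ⊥
      newRow-disjoint (y∈₁ , y∈₂)
        with T , T∈ , refl ← ∈-map⁻ withNewRow y∈₁
           | T′ , T′∈ , y∈ ← find (∈-concatMap⁻ insertions {xs = tableaux n (suc m)} y∈₂)
        with _ , i ← ∈-insertions⁻ T′ y∈ =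
          let t′ = proj₁ (∈-tableaux⁻ n (suc m) T′∈) in
          withNewRow≢inserted i (isTableau⇒belowN (proj₁ (∈-tableaux⁻ n m T∈))) (isTableau⇒belowN t′)
                              (IsTableau.rowsNonEmpty t′) refl

    concat-withNewRow : ∀ T → concat (withNewRow T) ↭ N ∷ concat T
    concat-withNewRow []       = ↭-refl
    concat-withNewRow (r ∷ rs) = ↭-trans (++⁺ˡ r (concat-withNewRow rs)) (shift N r (concat rs))

    concat-inserted : ∀ {p T y} → InsertedBelow p T y → concat y ↭ N ∷ concat T
    concat-inserted (here {r = r} {rs} _) = begin
      (r ++ [ N ]) ++ concat rs  ≡⟨ ++-assoc r [ N ] (concat rs) ⟩
      r ++ N ∷ concat rs         ↭⟨ shift N r (concat rs) ⟩
      N ∷ r ++ concat rs         ∎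
      where open PermutationReasoning
    concat-inserted (there {r = r} {rs} i) = ↭-trans (++⁺ˡ r (concat-inserted i)) (shift N r (concat rs))

    entries-grow : ∀ {L L′} → L′ ↭ N ∷ L → L ↭ oneTo n → L′ ↭ oneTo N
    entries-grow L′↭N∷L L↭oneTo = ↭-trans L′↭N∷L (↭-trans (↭-prep N L↭oneTo) (↭-sym (oneTo-suc↭ n)))

    entries-shrink : ∀ {L L′} → L′ ↭ N ∷ L → L′ ↭ oneTo N → L ↭ oneTo n
    entries-shrink L′↭N∷L L′↭oneTo = drop-∷ (↭-trans (↭-sym L′↭N∷L) (↭-trans L′↭oneTo (oneTo-suc↭ n)))

    withNewRow-isTableau : ∀ {T} → IsTableau n T → IsTableau N (withNewRow T)
    withNewRow-isTableau {T} t = record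
      { rowsNonEmpty      = All.++⁺ rowsNonEmpty (s≤s z≤n ∷ [])
      ; rowsIncreasing    = All.++⁺ rowsIncreasing ([-] ∷ [])
      ; columnsIncreasing = Linked-∷ʳ⁺ columnsIncreasing (All.zipWith above-N (rowsNonEmpty , isTableau⇒belowN t))
      ; entries           = entries-grow (concat-withNewRow T) entries
      }
      where
      open IsTableau t
      above-N : ∀ {r} → 1 ≤ length r × All (_< N) r → ColBelow r [ N ]
      above-N {_ ∷ _} (_ , a<N ∷ _) = a<N ∷ []

    withNewRow-isTableau⁻ : ∀ {T} → IsTableau N (withNewRow T) → IsTableau n T
    withNewRow-isTableau⁻ {T} t = record
      { rowsNonEmpty      = All.++⁻ˡ T rowsNonEmpty
      ; rowsIncreasing    = All.++⁻ˡ T rowsIncreasing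
      ; columnsIncreasing = Linked-++⁻ˡ T columnsIncreasing
      ; entries           = entries-shrink (concat-withNewRow T) entries
      }
      where open IsTableau t

    private
      columns-extendTop⁺ : ∀ {r rs} → Linked ColBelow (r ∷ rs) → Linked ColBelow ((r ++ [ N ]) ∷ rs)
      columns-extendTop⁺ [-]         = [-]
      columns-extendTop⁺ (r<s ∷ col) = ColBelow-∷ʳ-upper⁺ r<s ∷ col

      columns-extendTop⁻ : ∀ {r rs} → Linked ColBelow ((r ++ [ N ]) ∷ rs) → BelowN rs → Linked ColBelow (r ∷ rs)
      columns-extendTop⁻ [-]         _           = [-]
      columns-extendTop⁻ (r<s ∷ col) (s<N ∷ _) = ColBelow-∷ʳ-upper⁻ r<s s<N ∷ col

      columnsUnder⁺ : ∀ {prev T y} → InsertedBelow (length prev) T y → All (_< N) prev → BelowN T →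
                      Linked ColBelow (prev ∷ T) → Linked ColBelow (prev ∷ y)
      columnsUnder⁺ (here |r|<|prev|) prev<N _ (prev<r ∷ col) =
        ColBelow-∷ʳ-lower⁺ prev<r |r|<|prev| prev<N ∷ columns-extendTop⁺ col
      columnsUnder⁺ (there i) _ (r<N ∷ rs<N) (prev<r ∷ col) = prev<r ∷ columnsUnder⁺ i r<N rs<N col

      columnsUnder⁻ : ∀ {p prev T y} → InsertedBelow p T y → BelowN T →
                      Linked ColBelow (prev ∷ y) → Linked ColBelow (prev ∷ T)
      columnsUnder⁻ (here _)  (_ ∷ rs<N) (prev<r ∷ col) = ColBelow-∷ʳ-lower⁻ prev<r ∷ columns-extendTop⁻ col rs<N
      columnsUnder⁻ (there i) (_ ∷ T<N)  (prev<r ∷ col) = prev<r ∷ columnsUnder⁻ i T<N col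

    inserted-columns : ∀ {p T y} → InsertedBelow p T y → BelowN T → Linked ColBelow T → Linked ColBelow y
    inserted-columns (here _)  _            col = columns-extendTop⁺ col
    inserted-columns (there i) (r<N ∷ rs<N) col = columnsUnder⁺ i r<N rs<N col

    inserted-columns⁻ : ∀ {p T y} → InsertedBelow p T y → BelowN T → Linked ColBelow y → Linked ColBelow T
    inserted-columns⁻ (here _)  (_ ∷ rs<N) col = columns-extendTop⁻ col rs<N
    inserted-columns⁻ (there i) (_ ∷ rs<N) col = columnsUnder⁻ i rs<N col

    inserted-rowsNonEmpty : ∀ {p T y} → InsertedBelow p T y → NonEmptyRows T → NonEmptyRows y
    inserted-rowsNonEmpty (here {r = []} _)    (_ ∷ T≠[]) = s≤s z≤n ∷ T≠[]
    inserted-rowsNonEmpty (here {r = _ ∷ _} _) (_ ∷ T≠[]) = s≤s z≤n ∷ T≠[]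
    inserted-rowsNonEmpty (there i) (r≠[] ∷ rs≠[]) = r≠[] ∷ inserted-rowsNonEmpty i rs≠[]

    inserted-rowsIncreasing : ∀ {p T y} → InsertedBelow p T y → BelowN T → All (Linked _<_) T → All (Linked _<_) y
    inserted-rowsIncreasing (here _)  (r<N ∷ _)   (r↑ ∷ rs↑) = Linked-∷ʳ⁺ r↑ r<N ∷ rs↑
    inserted-rowsIncreasing (there i) (_ ∷ rs<N)  (r↑ ∷ rs↑) = r↑ ∷ inserted-rowsIncreasing i rs<N rs↑

    inserted-rowsIncreasing⁻ : ∀ {p T y} → InsertedBelow p T y → All (Linked _<_) y → All (Linked _<_) T
    inserted-rowsIncreasing⁻ (here {r = r} _) (r↑ ∷ rs↑) = Linked-++⁻ˡ r r↑ ∷ rs↑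
    inserted-rowsIncreasing⁻ (there i)        (r↑ ∷ rs↑) = r↑ ∷ inserted-rowsIncreasing⁻ i rs↑

    inserted-isTableau : ∀ {p T y} → InsertedBelow p T y → IsTableau n T → IsTableau N y
    inserted-isTableau i t = record
      { rowsNonEmpty      = inserted-rowsNonEmpty i rowsNonEmpty
      ; rowsIncreasing    = inserted-rowsIncreasing i (isTableau⇒belowN t) rowsIncreasing
      ; columnsIncreasing = inserted-columns i (isTableau⇒belowN t) columnsIncreasing
      ; entries           = entries-grow (concat-inserted i) entries
      }
      where open IsTableau t

    inserted-isTableau⁻ : ∀ {p T y} → InsertedBelow p T y → NonEmptyRows T → BelowN T → IsTableau N y → IsTableau n T
    inserted-isTableau⁻ i T≠[] T<N t = record
      { rowsNonEmpty      = T≠[]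
      ; rowsIncreasing    = inserted-rowsIncreasing⁻ i rowsIncreasing
      ; columnsIncreasing = inserted-columns⁻ i T<N columnsIncreasing
      ; entries           = entries-shrink (concat-inserted i) entries
      }
      where open IsTableau t

    Origin : ℕ → List (List ℕ) → Set
    Origin p y = ∃ λ T → (y ≡ withNewRow T ⊎ InsertedBelow p T y) × NonEmptyRows T × BelowN T

    private
      <N-of-≤N : ∀ {xs} → All (_≤ N) xs → (N ∈ xs → ⊥) → All (_< N) xs
      <N-of-≤N xs≤N N∉xs = All.tabulate λ x∈ → ≤∧≢⇒< (All.lookup xs≤N x∈) λ { refl → N∉xs x∈ }

      belowN : ∀ {T} → All (All (_≤ N)) T → (N ∈ concat T → ⊥) → BelowN T
      belowN T≤N N∉T = All.concat⁻ (<N-of-≤N (All.concat⁺ T≤N) N∉T)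

    originOfRowEndingInN : ∀ {p} r ys → length (r ++ [ N ]) ≤ p → Linked ColBelow ((r ++ [ N ]) ∷ ys) →
                           NonEmptyRows ys → All (_< N) r → BelowN ys → Origin p ((r ++ [ N ]) ∷ ys)
    originOfRowEndingInN []      []            _ _ _ _ _ = [] , inj₁ refl , [] , []
    originOfRowEndingInN []      ([] ∷ _)      _ _ (() ∷ _) _ _
    originOfRowEndingInN []      ((_ ∷ _) ∷ _) _ ((N<b ∷ _) ∷ _) _ _ ((b<N ∷ _) ∷ _) =
      ⊥-elim (<-irrefl refl (<-trans N<b b<N))
    originOfRowEndingInN {p} r@(_ ∷ _) ys |row|≤p _ ys≠[] r<N ys<N =
      r ∷ ys , inj₂ (here |r|<p) , s≤s z≤n ∷ ys≠[] , r<N ∷ ys<N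
      where
      |r|<p : length r < p
      |r|<p = subst (_≤ p) (trans (length-++ r) (+-comm (length r) 1)) |row|≤p

    origin : ∀ p row ys → length row ≤ p → All (Linked _<_) (row ∷ ys) → Linked ColBelow (row ∷ ys) →
             NonEmptyRows (row ∷ ys) → All (All (_≤ N)) (row ∷ ys) → Unique (concat (row ∷ ys)) →
             N ∈ concat (row ∷ ys) → Origin p (row ∷ ys)
    origin p row ys |row|≤p (row↑ ∷ ys↑) col (row≠[] ∷ ys≠[]) (row≤N ∷ ys≤N) y! N∈y
      with Unique-++⁻ row y! | ∈-++⁻ row N∈y
    ... | _ , row#ys | inj₁ N∈row with r , refl ← Linked-<-last row↑ row≤N N∈row =
      originOfRowEndingInN r ys |row|≤p col ys≠[] (Linked-<-∷ʳ⁻ r row↑) (belowN ys≤N (row#ys N∈row))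
    origin p row [] _ _ _ _ _ _ _ | _ | inj₂ ()
    origin p row (s ∷ ss) |row|≤p (row↑ ∷ ys↑) (row<s ∷ col) (row≠[] ∷ ys≠[]) (row≤N ∷ ys≤N) y! N∈y
      | ys! , row#ys | inj₂ N∈ys
      with T , grows , T≠[] , T<N ← origin (length row) s ss (ColBelow⇒≤ row<s) ys↑ col ys≠[] ys≤N ys! N∈ys =
      row ∷ T , extend grows , row≠[] ∷ T≠[] , <N-of-≤N row≤N (λ N∈row → row#ys N∈row N∈ys) ∷ T<N
      where
      extend : s ∷ ss ≡ withNewRow T ⊎ InsertedBelow (length row) T (s ∷ ss) →
               row ∷ s ∷ ss ≡ withNewRow (row ∷ T) ⊎ InsertedBelow p (row ∷ T) (row ∷ s ∷ ss)
      extend (inj₁ eq) = inj₁ (cong (row ∷_) eq)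
      extend (inj₂ i)  = inj₂ (there i)

    ∈-grownTableaux⁻ : ∀ m {y} → y ∈ grownTableaux m → IsTableau N y × length y ≡ suc m
    ∈-grownTableaux⁻ m y∈ with ∈-++⁻ (map withNewRow (tableaux n m)) y∈
    ... | inj₁ y∈₁ with T , T∈ , refl ← ∈-map⁻ withNewRow y∈₁ with t , |T|≡m ← ∈-tableaux⁻ n m T∈ =
      withNewRow-isTableau t , trans (withNewRow-length T) (cong suc |T|≡m)
    ... | inj₂ y∈₂ with T , T∈ , y∈ins ← find (∈-concatMap⁻ insertions {xs = tableaux n (suc m)} y∈₂)
      with _ , i ← ∈-insertions⁻ T y∈ins with t , |T|≡1+m ← ∈-tableaux⁻ n (suc m) T∈ =
      inserted-isTableau i t , trans (inserted-length i) |T|≡1+m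

    ∈-grownTableaux⁺ : ∀ m {y} → IsTableau N y → length y ≡ suc m → y ∈ grownTableaux m
    ∈-grownTableaux⁺ m {row ∷ ys} t |y|≡1+m
      with origin (suc (length row)) row ys (ℕₚ.n≤1+n _) rowsIncreasing columnsIncreasing
                  rowsNonEmpty y≤N y! N∈y
      where
      open IsTableau t
      y! : Unique (concat (row ∷ ys))
      y! = Unique-resp-↭ (↭⇒↭ₛ (↭-sym entries)) (oneTo-unique N)
      N∈y : N ∈ concat (row ∷ ys)
      N∈y = ∈-resp-↭ (↭-sym entries) (∈-oneTo⁺ (s≤s z≤n) ≤-refl)
      y≤N : All (All (_≤ N)) (row ∷ ys)
      y≤N = All.concat⁻ (All-resp-↭ (↭-sym entries) (All.tabulate (proj₂ ∘ ∈-oneTo⁻)))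
    ... | T , inj₁ y≡T+N , _ , _ =
      ∈-++⁺ˡ (subst (_∈ map withNewRow (tableaux n m)) (sym y≡T+N)
                    (∈-map⁺ withNewRow (∈-tableaux⁺ (withNewRow-isTableau⁻ (subst (IsTableau N) y≡T+N t)) |T|≡m)))
      where
      |T|≡m : length T ≡ m
      |T|≡m = suc-injective (trans (sym (withNewRow-length T)) (trans (cong length (sym y≡T+N)) |y|≡1+m))
    ... | T , inj₂ i , T≠[] , T<N =
      ∈-++⁺ʳ (map withNewRow (tableaux n m))
             (∈-concatMap⁺ insertions (lose (∈-tableaux⁺ (inserted-isTableau⁻ i T≠[] T<N t)
                                                         (trans (sym (inserted-length i)) |y|≡1+m))
                                            (∈-insertions⁺ i)))

    data RowExtension : List ℕ → List ℕ → Set where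
      keep   : ∀ {s} → RowExtension s s
      append : ∀ {s} → RowExtension s (s ++ [ N ])

    data Extension : List (List ℕ) → List (List ℕ) → Set where
      []     : Extension [] []
      newRow : Extension [] [ [ N ] ]
      _∷_    : ∀ {s s′ ss ss′} → RowExtension s s′ → Extension ss ss′ → Extension (s ∷ ss) (s′ ∷ ss′)

    Extension-refl : ∀ T → Extension T T
    Extension-refl []       = []
    Extension-refl (r ∷ rs) = keep ∷ Extension-refl rs

    inserted-extension : ∀ {p T y} → InsertedBelow p T y → Extension T y
    inserted-extension (here {rs = rs} _) = append ∷ Extension-refl rs
    inserted-extension (there i)          = keep ∷ inserted-extension i

    withNewRow-extension : ∀ T → Extension T (withNewRow T)
    withNewRow-extension []       = newRow
    withNewRow-extension (r ∷ rs) = keep ∷ withNewRow-extension rs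

    private
      LtM-at-∷ʳ⁺ : ∀ s k {x} → LtM (at s k) x → LtM (at (s ++ [ N ]) k) x
      LtM-at-∷ʳ⁺ (_ ∷ _) zero    a<x = a<x
      LtM-at-∷ʳ⁺ (_ ∷ s) (suc k) a<x = LtM-at-∷ʳ⁺ s k a<x

      LtM-at-∷ʳ⁻ : ∀ s k {x} → x ≤ N → LtM (at (s ++ [ N ]) k) x → LtM (at s k) x
      LtM-at-∷ʳ⁻ []      zero    x≤N N<x = <-irrefl refl (<-≤-trans N<x x≤N)
      LtM-at-∷ʳ⁻ (_ ∷ _) zero    _   a<x = a<x
      LtM-at-∷ʳ⁻ (_ ∷ s) (suc k) x≤N a<x = LtM-at-∷ʳ⁻ s k x≤N a<x

    cnt-extension : ∀ {rows rows′} → Extension rows rows′ → ∀ k x → x ≤ N → cnt rows′ k x ≡ cnt rows k x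
    cnt-extension []     k       x x≤N = refl
    cnt-extension newRow zero    x x≤N =
      cong length (filter-reject (λ s → ltM? (at s 0) x) {x = [ N ]} {xs = []}
                                 λ N<x → <-irrefl refl (<-≤-trans N<x x≤N))
    cnt-extension newRow (suc k) x x≤N = refl
    cnt-extension (_∷_ {s} {s′} {ss} {ss′} e es) k x x≤N with ltM? (at s k) x | ltM? (at s′ k) x
    ... | yes _  | yes _  = cong suc (cnt-extension es k x x≤N)
    ... | no _   | no _   = cnt-extension es k x x≤N
    cnt-extension (keep ∷ _)       k x x≤N | yes lt | no ≮ = ⊥-elim (≮ lt)
    cnt-extension (keep ∷ _)       k x x≤N | no ≮   | yes lt = ⊥-elim (≮ lt)
    cnt-extension (append {s} ∷ _) k x x≤N | yes lt | no ≮ = ⊥-elim (≮ (LtM-at-∷ʳ⁺ s k lt))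
    cnt-extension (append {s} ∷ _) k x x≤N | no ≮   | yes lt = ⊥-elim (≮ (LtM-at-∷ʳ⁻ s k x≤N lt))

    #rows≥ : ℕ → List (List ℕ) → ℕ
    #rows≥ v rs = length (filter (λ s → v ≤? length s) rs)

    #rows≥-∷ : ∀ {v} s ss → v ≤ length s → #rows≥ v (s ∷ ss) ≡ suc (#rows≥ v ss)
    #rows≥-∷ s ss v≤|s| = cong length (filter-accept (λ s → _ ≤? length s) {x = s} {xs = ss} v≤|s|)

    #rows≥-shorter : ∀ {v} s ss → Linked _≥_ (map length (s ∷ ss)) → length s < v → #rows≥ v (s ∷ ss) ≡ 0
    #rows≥-shorter {v} s ss shape |s|<v =
      trans (cong length (filter-reject (λ s → v ≤? length s) {x = s} {xs = ss} (<⇒≱ |s|<v))) (rest ss shape)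
      where
      open ℕₚ using (<⇒≱; ≤-<-trans)
      rest : ∀ ss → Linked _≥_ (length s ∷ map length ss) → #rows≥ v ss ≡ 0
      rest []        _                   = refl
      rest (t ∷ ts) (|t|≤|s| ∷ shape′) = #rows≥-shorter t ts shape′ (≤-<-trans |t|≤|s| |s|<v)

    private
      at-<length : ∀ s k → k < length s → ∃ λ a → at s k ≡ just a × a ∈ s
      at-<length (a ∷ s) zero    _ = a , refl , here refl
      at-<length (a ∷ s) (suc k) (s≤s k<|s|) with b , eq , b∈ ← at-<length s k k<|s| = b , eq , there b∈

      at-≥length : ∀ s k → length s ≤ k → at s k ≡ nothing
      at-≥length []      k       _         = refl
      at-≥length (a ∷ s) (suc k) (s≤s |s|≤k) = at-≥length s k |s|≤k

    cnt-N : ∀ {rs} → BelowN rs → ∀ k → cnt rs k N ≡ #rows≥ (suc k) rs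
    cnt-N []                 k = refl
    cnt-N {s ∷ rs} (s<N ∷ rs<N) k = by-cases (ltM? (at s k) N) (suc k ≤? length s)
      where
      P? = λ s → ltM? (at s k) N
      Q? = λ s → suc k ≤? length s
      by-cases : Dec (LtM (at s k) N) → Dec (suc k ≤ length s) → cnt (s ∷ rs) k N ≡ #rows≥ (suc k) (s ∷ rs)
      by-cases (yes lt) (yes reach)
        rewrite filter-accept P? {x = s} {xs = rs} lt | filter-accept Q? {x = s} {xs = rs} reach =
        cong suc (cnt-N rs<N k)
      by-cases (no ≮) (no ¬reach)
        rewrite filter-reject P? {x = s} {xs = rs} ≮ | filter-reject Q? {x = s} {xs = rs} ¬reach = cnt-N rs<N k
      by-cases (yes lt) (no ¬reach) with ℕₚ.≤-<-connex (length s) k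
      ... | inj₁ |s|≤k rewrite at-≥length s k |s|≤k = ⊥-elim lt
      ... | inj₂ reach = ⊥-elim (¬reach reach)
      by-cases (no ≮) (yes reach) with a , eq , a∈ ← at-<length s k reach =
        ⊥-elim (≮ (subst (λ z → LtM z N) (sym eq) (All.lookup s<N a∈)))

    cnt-appended : ∀ x xs rs → BelowN ((x ∷ xs) ∷ rs) →
                   cnt (((x ∷ xs) ++ [ N ]) ∷ rs) (length xs) N ≡ suc (#rows≥ (length (x ∷ xs)) rs)
    cnt-appended x xs rs (r<N ∷ rs<N) =
      trans (cong length (filter-accept (λ s → ltM? (at s (length xs)) N) {x = (x ∷ xs) ++ [ N ]} {xs = rs} last<N))
            (cong suc (cnt-N rs<N (length xs)))
      where
      at-∷ʳ : ∀ s k → k < length s → at (s ++ [ N ]) k ≡ at s k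
      at-∷ʳ (_ ∷ _) zero    _           = refl
      at-∷ʳ (_ ∷ s) (suc k) (s≤s k<|s|) = at-∷ʳ s k k<|s|
      last<N : LtM (at ((x ∷ xs) ++ [ N ]) (length xs)) N
      last<N with a , eq , a∈ ← at-<length (x ∷ xs) (length xs) ≤-refl =
        subst (λ z → LtM z N) (sym (trans (at-∷ʳ (x ∷ xs) (length xs) ≤-refl) eq)) (All.lookup r<N a∈)

open Tableaux

module TableauWeight {c ℓ : Level} (R : CommutativeSemiring c ℓ) (q : CommutativeSemiring.Carrier R) where
  open CommutativeSemiring R renaming (_+_ to _⊕_; _*_ to _⊗_)
  open QAnalogues R
  open ListSum R
  open import Algebra.Definitions.RawSemiring rawSemiring using (_^_)
  open import Algebra.Properties.Semiring.Exp semiring using (^-homo-*; ^-congʳ)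
  open import Algebra.Solver.Ring.NaturalCoefficients.Default R
  open import Relation.Binary.Reasoning.Setoid setoid

  -- The weight of a tableau whose top row is the (i+1)-st row of the ambient diagram.
  weightFrom : ℕ → List (List ℕ) → Carrier
  weightFrom i T = q ^ expoFrom i (map length T) ⊗ cqRows q T

  weight : List (List ℕ) → Carrier
  weight = weightFrom 0

  []q-cong : ∀ {a b} → a ≡ b → [ a ]q q ≈ [ b ]q q
  []q-cong = reflexive ∘ ≡.cong (λ a → [ a ]q q)

  [suc]q : ∀ k → [ suc k ]q q ≈ 1# ⊕ q ⊗ [ k ]q q
  [suc]q k = +-congˡ (powers-shift k (λ j → j))
    where
    powers-shift : ∀ k f → Σ-list (map (q ^_) (applyUpTo (suc ∘ f) k)) ≈ q ⊗ Σ-list (map (q ^_) (applyUpTo f k))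
    powers-shift zero    f = sym (zeroʳ q)
    powers-shift (suc k) f = trans (+-congˡ (powers-shift k (f ∘ suc))) (sym (distribˡ q _ _))

  open import Algebra.Properties.CommutativeSemigroup *-commutativeSemigroup using (interchange)

  private
    regroup : ∀ a α w b → a ⊗ (α ⊗ w) ⊕ α ⊗ ((q ⊗ a) ⊗ (b ⊗ w)) ≈ a ⊗ ((1# ⊕ q ⊗ b) ⊗ (α ⊗ w))
    regroup = solve 5 (λ q a α w b → a :* (α :* w) :+ α :* ((q :* a) :* (b :* w))
                                   := a :* ((con 1 :+ q :* b) :* (α :* w))) refl q

  module Growing (n : ℕ) where
    open Growth n

    rowProd-extension : ∀ {rows rows′} → Extension rows rows′ → ∀ {xs} → All (_≤ N) xs → ∀ k →
                        rowProd q rows′ k xs ≈ rowProd q rows k xs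
    rowProd-extension e []           k = refl
    rowProd-extension e (x≤N ∷ xs≤N) k =
      *-cong ([]q-cong (cnt-extension e k _ x≤N)) (rowProd-extension e xs≤N (suc k))

    private
      ≤N : ∀ {xs} → All (_< N) xs → All (_≤ N) xs
      ≤N = All.map ℕₚ.<⇒≤

    cqRows-withNewRow : ∀ {T} → NonEmptyRows T → BelowN T → cqRows q (withNewRow T) ≈ cqRows q T
    cqRows-withNewRow {[]}               []       []              = *-identityˡ 1#
    cqRows-withNewRow {(_ ∷ _) ∷ rs} (_ ∷ T≠[]) ((_ ∷ xs<N) ∷ T<N) =
      *-cong (rowProd-extension (keep ∷ withNewRow-extension rs) (≤N xs<N) 0) (cqRows-withNewRow T≠[] T<N)

    expoFrom-withNewRow : ∀ i T → expoFrom i (map length (withNewRow T)) ≡ expoFrom i (map length T)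
    expoFrom-withNewRow i []       = ≡.cong (_+ 0) (ℕₚ.*-zeroʳ i)
    expoFrom-withNewRow i (r ∷ rs) = ≡.cong (i * (length r ∸ 1) +_) (expoFrom-withNewRow (suc i) rs)

    weight-withNewRow : ∀ {T} → NonEmptyRows T → BelowN T → weight (withNewRow T) ≈ weight T
    weight-withNewRow {T} T≠[] T<N = *-cong (^-congʳ q (expoFrom-withNewRow 0 T)) (cqRows-withNewRow T≠[] T<N)

    rowFactor : ℕ → ℕ → List ℕ → List (List ℕ) → Carrier
    rowFactor i x xs rs = q ^ (i * length xs) ⊗ rowProd q ((x ∷ xs) ∷ rs) 0 xs

    weightFrom-∷ : ∀ i x xs {rs rs′} → Extension rs rs′ → All (_≤ N) xs →
                   weightFrom i ((x ∷ xs) ∷ rs′) ≈ rowFactor i x xs rs ⊗ weightFrom (suc i) rs′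
    weightFrom-∷ i x xs {rs′ = rs′} e xs≤N = begin
      q ^ (i * length xs + E) ⊗ (rowProd q ((x ∷ xs) ∷ rs′) 0 xs ⊗ cqRows q rs′)
        ≈⟨ *-cong (^-homo-* q (i * length xs) E) (*-congʳ (rowProd-extension (keep ∷ e) xs≤N 0)) ⟩
      (q ^ (i * length xs) ⊗ q ^ E) ⊗ (rowProd q ((x ∷ xs) ∷ _) 0 xs ⊗ cqRows q rs′)
        ≈⟨ interchange _ _ _ _ ⟩
      rowFactor i x xs _ ⊗ weightFrom (suc i) rs′ ∎
      where E = expoFrom (suc i) (map length rs′)

    ∑-weightFrom-∷ : ∀ i x xs rs L → (∀ {y} → y ∈ L → Extension rs y) → All (_< N) xs →
                     ∑ (weightFrom i) (map ((x ∷ xs) ∷_) L) ≈ rowFactor i x xs rs ⊗ ∑ (weightFrom (suc i)) L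
    ∑-weightFrom-∷ i x xs rs L ext xs<N = begin
      ∑ (weightFrom i) (map ((x ∷ xs) ∷_) L)                       ≈⟨ ∑-map (weightFrom i) ((x ∷ xs) ∷_) L ⟩
      ∑ (λ y → weightFrom i ((x ∷ xs) ∷ y)) L
        ≈⟨ ∑-cong L (λ y∈ → weightFrom-∷ i x xs (ext y∈) (≤N xs<N)) ⟩
      ∑ (λ y → rowFactor i x xs rs ⊗ weightFrom (suc i) y) L       ≈⟨ *-distribˡ-∑ _ (weightFrom (suc i)) L ⟨
      rowFactor i x xs rs ⊗ ∑ (weightFrom (suc i)) L               ∎

    rowProd-∷ʳ : ∀ rows k xs v →
                 rowProd q rows k (xs ++ [ v ]) ≈ rowProd q rows k xs ⊗ [ cnt rows (k + length xs) v ]q q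
    rowProd-∷ʳ rows k []       v =
      trans (*-comm _ _) (*-congˡ ([]q-cong (≡.cong (λ j → cnt rows j v) (≡.sym (ℕₚ.+-identityʳ k)))))
    rowProd-∷ʳ rows k (x ∷ xs) v = begin
      [ cnt rows k x ]q q ⊗ rowProd q rows (suc k) (xs ++ [ v ])
        ≈⟨ *-congˡ (rowProd-∷ʳ rows (suc k) xs v) ⟩
      [ cnt rows k x ]q q ⊗ (rowProd q rows (suc k) xs ⊗ [ cnt rows (suc k + length xs) v ]q q)
        ≈⟨ *-assoc _ _ _ ⟨
      ([ cnt rows k x ]q q ⊗ rowProd q rows (suc k) xs) ⊗ [ cnt rows (suc k + length xs) v ]q q
        ≈⟨ *-congˡ ([]q-cong (≡.cong (λ j → cnt rows j v) (≡.sym (ℕₚ.+-suc k (length xs))))) ⟩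
      ([ cnt rows k x ]q q ⊗ rowProd q rows (suc k) xs) ⊗ [ cnt rows (k + suc (length xs)) v ]q q ∎

    appendWeight : ℕ → ℕ → List ℕ → List (List ℕ) → Carrier
    appendWeight i x xs rs = q ^ i ⊗ ([ suc (#rows≥ (length (x ∷ xs)) rs) ]q q ⊗ weightFrom i ((x ∷ xs) ∷ rs))

    weightFrom-appended : ∀ i x xs rs → BelowN ((x ∷ xs) ∷ rs) →
                          weightFrom i (((x ∷ xs) ++ [ N ]) ∷ rs) ≈ appendWeight i x xs rs
    weightFrom-appended i x xs rs T<N@((_ ∷ xs<N) ∷ _) = begin
      q ^ (i * length (xs ++ [ N ]) + E) ⊗ (rowProd q rows′ 0 (xs ++ [ N ]) ⊗ cqRows q rs)
        ≈⟨ *-cong (^-congʳ q exponent) (*-congʳ (rowProd-∷ʳ rows′ 0 xs N)) ⟩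
      q ^ (i + (i * length xs + E)) ⊗ ((rowProd q rows′ 0 xs ⊗ [ cnt rows′ (length xs) N ]q q) ⊗ cqRows q rs)
        ≈⟨ *-cong (^-homo-* q i _) (*-congʳ (*-cong (rowProd-extension (append ∷ Extension-refl rs) (≤N xs<N) 0)
                                                    ([]q-cong (cnt-appended x xs rs T<N)))) ⟩
      (q ^ i ⊗ q ^ (i * length xs + E)) ⊗ ((rowProd q ((x ∷ xs) ∷ rs) 0 xs ⊗ [ suc k ]q q) ⊗ cqRows q rs)
        ≈⟨ solve 5 (λ a b d e f → (a :* b) :* ((d :* e) :* f) := a :* (e :* (b :* (d :* f)))) refl _ _ _ _ _ ⟩
      appendWeight i x xs rs ∎
      where
      E = expoFrom (suc i) (map length rs)
      k = #rows≥ (length (x ∷ xs)) rs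
      rows′ = ((x ∷ xs) ++ [ N ]) ∷ rs
      exponent : i * length (xs ++ [ N ]) + E ≡ i + (i * length xs + E)
      exponent = ≡.trans (≡.cong (λ l → i * l + E) (≡.trans (length-++ xs) (ℕₚ.+-comm (length xs) 1)))
                         (≡.trans (≡.cong (_+ E) (ℕₚ.*-suc i (length xs))) (ℕₚ.+-assoc i _ E))

    -- N is appended to x ∷ xs whether or not the row above admits it; this makes the sum telescope.
    weightOfInsertionsFrom : ℕ → ℕ → List ℕ → List (List ℕ) → Carrier
    weightOfInsertionsFrom i x xs rs =
      appendWeight i x xs rs ⊕ ∑ (weightFrom i) (map ((x ∷ xs) ∷_) (insertionsBelow (length (x ∷ xs)) rs))

    private
      [1]q⊗ : ∀ w → [ 1 ]q q ⊗ w ≈ w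
      [1]q⊗ w = trans (*-congʳ (+-identityʳ 1#)) (*-identityˡ w)

    weightOfInsertionsFrom-∷ : ∀ i x xs y ys ss → BelowN ((x ∷ xs) ∷ (y ∷ ys) ∷ ss) →
      Linked _≥_ (map length ((x ∷ xs) ∷ (y ∷ ys) ∷ ss)) →
      weightOfInsertionsFrom i x xs ((y ∷ ys) ∷ ss) ≈
        q ^ i ⊗ weightFrom i ((x ∷ xs) ∷ (y ∷ ys) ∷ ss)
        ⊕ rowFactor i x xs ((y ∷ ys) ∷ ss) ⊗ weightOfInsertionsFrom (suc i) y ys ss
    weightOfInsertionsFrom-∷ i x xs y ys ss ((_ ∷ xs<N) ∷ rest<N@(s<N ∷ ss<N)) (s≲r ∷ shape) =
      by-length (ℕₚ.m≤n⇒m<n∨m≡n s≲r)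
      where
      r = x ∷ xs; s = y ∷ ys; rest = s ∷ ss
      L = insertionsBelow (length r) rest
      M = map (s ∷_) (insertionsBelow (length s) ss)
      W = weightFrom i (r ∷ rest)
      W′ = weightFrom (suc i) rest
      α = rowFactor i x xs rest
      E′ = appendWeight (suc i) y ys ss
      k = #rows≥ (length s) ss

      W≈αW′ : W ≈ α ⊗ W′
      W≈αW′ = weightFrom-∷ i x xs (Extension-refl rest) (≤N xs<N)

      ∑L : ∑ (weightFrom i) (map (r ∷_) L) ≈ α ⊗ ∑ (weightFrom (suc i)) L
      ∑L = ∑-weightFrom-∷ i x xs rest L (λ t∈ → inserted-extension (∈-insertionsBelow⁻ _ rest t∈)) xs<N

      -- N cannot go into s, but s raises the count in appendWeight for r by one.
      appendWeight-sameLength : length s ≡ length r → appendWeight i x xs rest ≈ q ^ i ⊗ W ⊕ α ⊗ E′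
      appendWeight-sameLength sameLength = begin
        q ^ i ⊗ ([ suc (#rows≥ (length r) rest) ]q q ⊗ W)
          ≈⟨ *-congˡ (*-cong (trans ([]q-cong (≡.cong suc #rows≥-sameLength)) ([suc]q (suc k))) W≈αW′) ⟩
        q ^ i ⊗ ((1# ⊕ q ⊗ [ suc k ]q q) ⊗ (α ⊗ W′))                  ≈⟨ regroup _ _ _ _ ⟨
        q ^ i ⊗ (α ⊗ W′) ⊕ α ⊗ ((q ⊗ q ^ i) ⊗ ([ suc k ]q q ⊗ W′))   ≈⟨ +-congʳ (*-congˡ W≈αW′) ⟨
        q ^ i ⊗ W ⊕ α ⊗ E′                                             ∎
        where
        #rows≥-sameLength : #rows≥ (length r) rest ≡ suc k
        #rows≥-sameLength = ≡.trans (#rows≥-∷ s ss (ℕₚ.≤-reflexive (≡.sym sameLength)))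
                                    (≡.cong (λ v → suc (#rows≥ v ss)) (≡.sym sameLength))

      by-length : length s < length r ⊎ length s ≡ length r →
                  weightOfInsertionsFrom i x xs rest ≈ q ^ i ⊗ W ⊕ α ⊗ weightOfInsertionsFrom (suc i) y ys ss
      by-length (inj₁ shorter) = begin
        appendWeight i x xs rest ⊕ ∑ (weightFrom i) (map (r ∷_) L)
          ≈⟨ +-cong (*-congˡ (trans (*-congʳ ([]q-cong (≡.cong suc (#rows≥-shorter s ss shape shorter))))
                                    ([1]q⊗ W)))
                    ∑L ⟩
        q ^ i ⊗ W ⊕ α ⊗ ∑ (weightFrom (suc i)) L
          ≈⟨ +-congˡ (*-congˡ (trans (∑-onlyIf-yes (weightFrom (suc i)) (length s <? length r) shorter _ M)
                                     (+-congʳ (weightFrom-appended (suc i) y ys ss rest<N)))) ⟩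
        q ^ i ⊗ W ⊕ α ⊗ weightOfInsertionsFrom (suc i) y ys ss ∎
      by-length (inj₂ sameLength) = begin
        appendWeight i x xs rest ⊕ ∑ (weightFrom i) (map (r ∷_) L)
          ≈⟨ +-cong (appendWeight-sameLength sameLength)
                    (trans ∑L (*-congˡ (∑-onlyIf-no (weightFrom (suc i)) (length s <? length r)
                                                    (ℕₚ.<-irrefl sameLength) _ M))) ⟩
        (q ^ i ⊗ W ⊕ α ⊗ E′) ⊕ α ⊗ ∑ (weightFrom (suc i)) M      ≈⟨ +-assoc _ _ _ ⟩
        q ^ i ⊗ W ⊕ (α ⊗ E′ ⊕ α ⊗ ∑ (weightFrom (suc i)) M)      ≈⟨ +-congˡ (distribˡ α _ _) ⟨
        q ^ i ⊗ W ⊕ α ⊗ weightOfInsertionsFrom (suc i) y ys ss  ∎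

    weightOfInsertionsFrom≈ : ∀ i x xs rs → NonEmptyRows rs → BelowN ((x ∷ xs) ∷ rs) →
      Linked _≥_ (map length ((x ∷ xs) ∷ rs)) →
      weightOfInsertionsFrom i x xs rs ≈ q ^ i ⊗ ([ suc (length rs) ]q q ⊗ weightFrom i ((x ∷ xs) ∷ rs))
    weightOfInsertionsFrom≈ i x xs []               _          _ _ = +-identityʳ _
    weightOfInsertionsFrom≈ i x xs ((y ∷ ys) ∷ ss) (_ ∷ ss≠[]) T<N@((_ ∷ xs<N) ∷ rest<N) shape@(_ ∷ shape′) = begin
      weightOfInsertionsFrom i x xs rest
        ≈⟨ weightOfInsertionsFrom-∷ i x xs y ys ss T<N shape ⟩
      q ^ i ⊗ W ⊕ α ⊗ weightOfInsertionsFrom (suc i) y ys ss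
        ≈⟨ +-cong (*-congˡ W≈αW′) (*-congˡ (weightOfInsertionsFrom≈ (suc i) y ys ss ss≠[] rest<N shape′)) ⟩
      q ^ i ⊗ (α ⊗ W′) ⊕ α ⊗ ((q ⊗ q ^ i) ⊗ ([ suc (length ss) ]q q ⊗ W′))
        ≈⟨ regroup _ _ _ _ ⟩
      q ^ i ⊗ ((1# ⊕ q ⊗ [ suc (length ss) ]q q) ⊗ (α ⊗ W′))
        ≈⟨ *-congˡ (*-cong ([suc]q (suc (length ss))) W≈αW′) ⟨
      q ^ i ⊗ ([ suc (length rest) ]q q ⊗ W) ∎
      where
      rest = (y ∷ ys) ∷ ss
      W = weightFrom i ((x ∷ xs) ∷ rest)
      W′ = weightFrom (suc i) rest
      α = rowFactor i x xs rest
      W≈αW′ : W ≈ α ⊗ W′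
      W≈αW′ = weightFrom-∷ i x xs (Extension-refl rest) (≤N xs<N)

    ∑-weight-insertions : ∀ {T} → IsTableau n T → ∑ weight (insertions T) ≈ [ length T ]q q ⊗ weight T
    ∑-weight-insertions {[]}             _ = sym (zeroˡ _)
    ∑-weight-insertions {[] ∷ _}         t with () ∷ _ ← IsTableau.rowsNonEmpty t
    ∑-weight-insertions {(x ∷ xs) ∷ rs} t = begin
      ∑ weight (onlyIf (length r <? suc (length r)) ((r ++ [ N ]) ∷ rs) ++ map (r ∷_) (insertionsBelow (length r) rs))
        ≈⟨ ∑-onlyIf-yes weight (length r <? suc (length r)) (ℕₚ.n<1+n _) _ _ ⟩
      weight ((r ++ [ N ]) ∷ rs) ⊕ ∑ weight (map (r ∷_) (insertionsBelow (length r) rs))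
        ≈⟨ +-congʳ (weightFrom-appended 0 x xs rs T<N) ⟩
      weightOfInsertionsFrom 0 x xs rs
        ≈⟨ weightOfInsertionsFrom≈ 0 x xs rs (All.tail rowsNonEmpty) T<N (shape-decreasing columnsIncreasing) ⟩
      1# ⊗ ([ length T ]q q ⊗ weight T)
        ≈⟨ *-identityˡ _ ⟩
      [ length T ]q q ⊗ weight T ∎
      where
      open IsTableau t
      r = x ∷ xs
      T = r ∷ rs
      T<N = isTableau⇒belowN t

module Stirling {c ℓ : Level} (R : CommutativeSemiring c ℓ) (q : CommutativeSemiring.Carrier R) where
  open CommutativeSemiring R renaming (_+_ to _⊕_; _*_ to _⊗_)
  open QAnalogues R
  open ListSum R
  open TableauWeight R q
  open import Algebra.Definitions.RawSemiring rawSemiring using (_^_)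
  open import Relation.Binary.Reasoning.Setoid setoid

  S : ℕ → ℕ → Carrier
  S n m = ∑ weight (tableaux n m)

  rhs≈S : ∀ n m → rhs q n m ≈ S n m
  rhs≈S n m = begin
    ∑ (λ μ → q ^ expo μ ⊗ ∑ (cq q) (stdTabs n μ)) (partitionsWithParts n m)
      ≈⟨ ∑-cong (partitionsWithParts n m) (λ {μ} _ → trans (*-distribˡ-∑ (q ^ expo μ) (cq q) (stdTabs n μ))
                                                            (∑-cong (stdTabs n μ) (shape-weight μ))) ⟩
    ∑ (λ μ → ∑ weight (stdTabs n μ)) (partitionsWithParts n m)
      ≈⟨ ∑-concatMap weight (stdTabs n) (partitionsWithParts n m) ⟨
    S n m ∎
    where
    shape-weight : ∀ μ {T} → T ∈ stdTabs n μ → q ^ expo μ ⊗ cq q T ≈ weight T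
    shape-weight μ T∈ = *-congʳ (reflexive (≡.cong (λ μ → q ^ expo μ) (≡.sym shape)))
      where shape = proj₁ (∈-stdTabs⁻ {n} {μ} T∈)

  S-recurrence : ∀ n m → S (suc n) (suc m) ≈ S n m ⊕ [ suc m ]q q ⊗ S n (suc m)
  S-recurrence n m = begin
    ∑ weight (tableaux (suc n) (suc m))
      ≈⟨ ∑-sameElements weight (tableaux-unique (suc n) (suc m)) (grownTableaux-unique m)
                        (mk⇔ (λ T∈ → let t , len = ∈-tableaux⁻ (suc n) (suc m) T∈ in ∈-grownTableaux⁺ m t len)
                             (λ T∈ → let t , len = ∈-grownTableaux⁻ m T∈ in ∈-tableaux⁺ t len)) ⟩
    ∑ weight (grownTableaux m)
      ≈⟨ ∑-++ weight (map withNewRow (tableaux n m)) _ ⟩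
    ∑ weight (map withNewRow (tableaux n m)) ⊕ ∑ weight (concatMap insertions (tableaux n (suc m)))
      ≈⟨ +-cong (trans (∑-map weight withNewRow (tableaux n m)) (∑-cong (tableaux n m) newRow-weight))
                (trans (∑-concatMap weight insertions (tableaux n (suc m)))
                       (∑-cong (tableaux n (suc m)) insertions-weight)) ⟩
    S n m ⊕ ∑ (λ T → [ suc m ]q q ⊗ weight T) (tableaux n (suc m))
      ≈⟨ +-congˡ (*-distribˡ-∑ _ weight (tableaux n (suc m))) ⟨
    S n m ⊕ [ suc m ]q q ⊗ S n (suc m) ∎
    where
    open Growth n
    open Growing n
    newRow-weight : ∀ {T} → T ∈ tableaux n m → weight (withNewRow T) ≈ weight T
    newRow-weight T∈ = let t = proj₁ (∈-tableaux⁻ n m T∈) in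
      weight-withNewRow (IsTableau.rowsNonEmpty t) (isTableau⇒belowN t)
    insertions-weight : ∀ {T} → T ∈ tableaux n (suc m) → ∑ weight (insertions T) ≈ [ suc m ]q q ⊗ weight T
    insertions-weight {T} T∈ with t , |T|≡1+m ← ∈-tableaux⁻ n (suc m) T∈ =
      trans (∑-weight-insertions t) (*-congʳ ([]q-cong |T|≡1+m))

  Sq≈S : ∀ n m → Sq q n m ≈ S n m
  Sq≈S zero    zero    = sym (trans (+-identityʳ _) (*-identityˡ 1#))
  Sq≈S zero    (suc m) = sym (∑-∉ weight λ T∈ → empty (∈-tableaux⁻ 0 (suc m) T∈))
    where
    empty : ∀ {T} → IsTableau 0 T × length T ≡ suc m → ⊥
    empty {[] ∷ _}      (t , _) with () ∷ _ ← IsTableau.rowsNonEmpty t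
    empty {(_ ∷ _) ∷ _} (t , _) with () ← IsTableau-size t
  Sq≈S (suc n) zero    = sym (∑-∉ weight λ T∈ → empty (∈-tableaux⁻ (suc n) 0 T∈))
    where
    empty : ∀ {T} → IsTableau (suc n) T × length T ≡ 0 → ⊥
    empty {[]} (t , _) with () ← IsTableau-size t
  Sq≈S (suc n) (suc m) = trans (+-cong (Sq≈S n m) (*-congˡ (Sq≈S n (suc m)))) (sym (S-recurrence n m))

theorem3p11 : ∀ {c ℓ} (R : CommutativeSemiring c ℓ) (q : CommutativeSemiring.Carrier R) (n m : ℕ) →
    CommutativeSemiring._≈_ R (QAnalogues.Sq R q n m) (QAnalogues.rhs R q n m)
theorem3p11 R q n m = trans (Sq≈S n m) (sym (rhs≈S n m))
  where open Stirling R q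
        open CommutativeSemiring R using (trans; sym)
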